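{- Let $\Gamma$ be a totally ordered additive abelian group, $\overline{\Gamma}=\Gamma\sqcup\{\infty\}$, $E$ a finite set, and $\nu_{\mathsf{P}}\colon\Delta_E^r\to\overline{\Gamma}$ an $M$-convex function of rank $r$. Define $\widetilde{\nu}_{\mathsf{P}}\colon\Delta_E^{\le r}\to\overline{\Gamma}$ by $\widetilde{\nu}_{\mathsf{P}}(\alpha)=\min\{\nu_{\mathsf{P}}(\beta)\mid\beta\in\Delta_E^r,\ \alpha_e\le\beta_e\ \forall e\in E\}$. Let $Q$ be a finite set disjoint from $E$ and $\widetilde{E}=Q\sqcup E$. Then the map $\nu_{\widetilde{\mathsf{P}}}\colon\Delta_{\widetilde{E}}^r\to\overline{\Gamma}$ given by $\nu_{\widetilde{\mathsf{P}}}((\alpha_Q,\alpha))=\widetilde{\nu}_{\mathsf{P}}(\alpha)$ for $(\alpha_Q,\alpha)\in\Delta_{\widetilde{E}}^r$, where $\alpha\in\Delta_E^{\le r}$ and $\alpha_Q\in\Delta_Q^{r-|\alpha|}$, is an $M$-convex function.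
   Context: For a finite set $X$, $e_s\in\mathbb{Z}^X$ is the standard basis vector, $|\alpha|=\sum_{x}\alpha_x$, $\Delta_X^k=\{\alpha\in\mathbb{Z}_{\ge0}^X\mid|\alpha|=k\}$, $\Delta_X^{\le r}=\{\alpha\in\mathbb{Z}_{\ge0}^X\mid|\alpha|\le r\}$. An $M$-convex function of rank $r$ on $X$ is a function $\nu\colon\Delta_X^r\to\overline{\Gamma}$, not identically $\infty$, such that for all $\alpha,\beta\in\Delta_X^r$ and $s\in X$ with $\alpha_s>\beta_s$ there exists $t\in X$ with $\beta_t>\alpha_t$ and $\nu(\alpha)+\nu(\beta)\ge\nu(\alpha-e_s+e_t)+\nu(\beta-e_t+e_s)$. Here $\infty$ exceeds all elements of $\Gamma$ and $\infty+a=\infty$. -}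

module Defs where

open import Level using (Level; _⊔_; suc)
open import Algebra.Bundles using (AbelianGroup)
open import Relation.Binary.Structures using (IsTotalOrder)
open import Relation.Binary.PropositionalEquality using (_≡_)
open import Relation.Nullary using (¬_; yes; no)
open import Data.Nat as ℕ using (ℕ; zero; _∸_)
open import Data.Fin using (Fin; _≟_; _↑ˡ_; _↑ʳ_)
import Data.Fin as F
open import Data.Product using (Σ; _×_; _,_; ∃)
open import Data.Empty using (⊥)
open import Data.Unit using (⊤)

record TotallyOrderedAbelianGroup (c ℓ₁ ℓ₂ : Level) : Set (Level.suc (c ⊔ ℓ₁ ⊔ ℓ₂)) where
  field
    abelianGroup : AbelianGroup c ℓ₁
  open AbelianGroup abelianGroup public
  infix 4 _≤_
  field
    _≤_         : Carrier → Carrier → Set ℓ₂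
    isTotalOrder : IsTotalOrder _≈_ _≤_
    ≤-translate  : ∀ a b c → a ≤ b → (a ∙ c) ≤ (b ∙ c)

module Extended {c ℓ₁ ℓ₂} (Γ : TotallyOrderedAbelianGroup c ℓ₁ ℓ₂) where
  open TotallyOrderedAbelianGroup Γ

  data Γ̄ : Set c where
    fin : Carrier → Γ̄
    ∞   : Γ̄

  infixl 6 _+̄_
  _+̄_ : Γ̄ → Γ̄ → Γ̄
  fin a +̄ fin b = fin (a ∙ b)
  fin a +̄ ∞     = ∞
  ∞     +̄ _     = ∞

  infix 4 _≤̄_ _≈̄_
  data _≤̄_ : Γ̄ → Γ̄ → Set (c ⊔ ℓ₂) where
    fin≤fin : ∀ {a b} → a ≤ b → fin a ≤̄ fin b
    _≤∞     : ∀ x → x ≤̄ ∞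

  data _≈̄_ : Γ̄ → Γ̄ → Set (c ⊔ ℓ₁) where
    fin≈fin : ∀ {a b} → a ≈ b → fin a ≈̄ fin b
    ∞≈∞     : ∞ ≈̄ ∞

∣_∣ : ∀ {k} → (Fin k → ℕ) → ℕ
∣_∣ {zero}    α = 0
∣_∣ {ℕ.suc k} α = α F.zero ℕ.+ ∣ (λ i → α (F.suc i)) ∣

e : ∀ {k} → Fin k → Fin k → ℕ
e s x with x ≟ s
... | yes _ = 1
... | no  _ = 0

-- α - e_s + e_t  (only used when α_s ≥ 1, so ∸ is exact subtraction)
exch : ∀ {k} → (Fin k → ℕ) → Fin k → Fin k → (Fin k → ℕ)
exch α s t x = (α x ∸ e s x) ℕ.+ e t x

module _ {c ℓ₁ ℓ₂} (Γ : TotallyOrderedAbelianGroup c ℓ₁ ℓ₂) where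
  open Extended Γ

  -- ν : Δ_X^r → Γ̄ represented as a function on ℤ_{≥0}^X whose values
  -- outside Δ_X^r are irrelevant (only values on Δ_X^r are ever used).
  IsMConvex : ∀ {k} (r : ℕ) → ((Fin k → ℕ) → Γ̄) → Set (c ⊔ ℓ₂)
  IsMConvex {k} r ν =
    (Σ (Fin k → ℕ) λ α → (∣ α ∣ ≡ r) × ¬ (ν α ≡ ∞))
    × (∀ (α β : Fin k → ℕ) → ∣ α ∣ ≡ r → ∣ β ∣ ≡ r →
         ∀ s → β s ℕ.< α s →
         Σ (Fin k) λ t → (α t ℕ.< β t) ×
           (ν (exch α s t) +̄ ν (exch β t s) ≤̄ ν α +̄ ν β))

  IsMinExtension : ∀ {n} (r : ℕ) → ((Fin n → ℕ) → Γ̄) → ((Fin n → ℕ) → Γ̄) → Set (c ⊔ ℓ₁ ⊔ ℓ₂)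
  IsMinExtension {n} r ν ν̃ =
    ∀ (α : Fin n → ℕ) → ∣ α ∣ ℕ.≤ r →
      (Σ (Fin n → ℕ) λ β → (∣ β ∣ ≡ r) × (∀ x → α x ℕ.≤ β x) × (ν̃ α ≈̄ ν β))
      × (∀ (β : Fin n → ℕ) → ∣ β ∣ ≡ r → (∀ x → α x ℕ.≤ β x) → ν̃ α ≤̄ ν β)

-- Ẽ = Q ⊔ E with Q = Fin q, E = Fin n, realised as Fin (q + n):
-- the first q indices are Q, the last n are E.
-- The E-part α of (α_Q, α) ∈ ℤ_{≥0}^{Ẽ}:
restrictE : ∀ {q n} → (Fin (q ℕ.+ n) → ℕ) → (Fin n → ℕ)
restrictE {q} α̃ x = α̃ (q ↑ʳ x)

-- ν̃ is M♮-convex on Δ_E^{≤ r}: the function (r − |α|, α) ↦ ν̃ α on Δ^r over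
-- {slack} ⊔ E is M-convex.  Since ν_P̃ sees the Q-part only through its total,
-- which is that slack, the coordinates of Q behave as copies of the slack
-- coordinate, and the exchange axiom of ν_P̃ is inherited from the one of this
-- homogenization (an exchange between two coordinates of Q changes nothing).
--
-- M♮-convexity of ν̃ is proved by induction on 2r − |x| − |y|.  A point x with
-- |x| < r can be raised in some coordinate i without increasing ν̃, an exchange
-- for the raised pair descends to one for (x, y) by monotonicity of ν̃, and for
-- |x| = |y| = r the exchange is the one of ν.

module Submission where

open import Defs
open import Level using (_⊔_)
open import Algebra.Properties.CommutativeSemigroup using (interchange)
open import Data.Empty using (⊥; ⊥-elim)
open import Data.Fin as Fin using (Fin; _≟_; _↑ˡ_; _↑ʳ_; splitAt)
import Data.Fin.Properties as FinP
open import Data.Nat using (ℕ; zero; suc; _+_; _∸_; _≤_; _<_; z≤n; s≤s; _<?_)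
open import Data.Nat.Properties hiding (_≟_)
open import Data.Product using (_×_; _,_; proj₁; proj₂; ∃-syntax)
open import Data.Sum using (_⊎_; inj₁; inj₂)
open import Data.Vec.Functional using (_++_)
open import Function using (_∘_; case_of_)
open import Relation.Binary.Bundles using (Poset)
open import Relation.Binary.Definitions using (tri<; tri≈; tri>)
open import Relation.Binary.PropositionalEquality
open import Relation.Binary.Structures using (IsTotalOrder)
open import Relation.Nullary using (yes; no)
open import Relation.Nullary.Negation using (contradiction)

private variable
  m n : ℕ
  u u′ v v′ w x y : Fin n → ℕ
  i j s : Fin n

complement-≤ : ∀ {a b c d} → a + b ≡ c + d → d ≤ b → a ≤ c
complement-≤ {a} {b} {c} {d} a+b≡c+d d≤b =
  +-cancelʳ-≤ b a c (subst (_≤ c + b) (sym a+b≡c+d) (+-monoʳ-≤ c d≤b))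

complement-< : ∀ {a b c d} → a + b ≡ c + d → d < b → a < c
complement-< {a} {b} {c} {d} a+b≡c+d d<b =
  +-cancelʳ-< b a c (subst (_< c + b) (sym a+b≡c+d) (+-monoʳ-< c d<b))

e-same : (s : Fin n) → e s s ≡ 1
e-same s with s ≟ s
... | yes _  = refl
... | no s≢s = contradiction refl s≢s

e-other : ∀ {s k : Fin n} → k ≢ s → e s k ≡ 0
e-other {s = s} {k} k≢s with k ≟ s
... | yes k≡s = contradiction k≡s k≢s
... | no _    = refl

e-suc : (s k : Fin n) → e (Fin.suc s) (Fin.suc k) ≡ e s k
e-suc s k with k ≟ s
... | yes _ = refl
... | no _  = refl

infixl 6 _+ₑ_ _-ₑ_
_+ₑ_ : (Fin n → ℕ) → Fin n → (Fin n → ℕ)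
(u +ₑ i) k = u k + e i k

_-ₑ_ : (Fin n → ℕ) → Fin n → (Fin n → ℕ)
(u -ₑ i) k = u k ∸ e i k

infix 4 _≤ᵥ_
_≤ᵥ_ : (Fin n → ℕ) → (Fin n → ℕ) → Set
u ≤ᵥ v = ∀ k → u k ≤ v k

+ₑ-self : (u : Fin n → ℕ) (i : Fin n) → (u +ₑ i) i ≡ suc (u i)
+ₑ-self u i = trans (cong (u i +_) (e-same i)) (+-comm (u i) 1)

0<+ₑ-self : (u : Fin n → ℕ) (i : Fin n) → 0 < (u +ₑ i) i
0<+ₑ-self u i = subst (0 <_) (sym (+ₑ-self u i)) (s≤s z≤n)

+ₑ-other : ∀ (u : Fin n → ℕ) {i k} → k ≢ i → (u +ₑ i) k ≡ u k
+ₑ-other u {k = k} k≢i = trans (cong (u k +_) (e-other k≢i)) (+-identityʳ (u k))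

-ₑ-other : ∀ (u : Fin n → ℕ) {s k} → k ≢ s → (u -ₑ s) k ≡ u k
-ₑ-other u {k = k} k≢s = cong (u k ∸_) (e-other k≢s)

+ₑ-cong : (i : Fin n) → u ≗ v → u +ₑ i ≗ v +ₑ i
+ₑ-cong i u≗v k = cong (_+ e i k) (u≗v k)

-ₑ-cong : (s : Fin n) → u ≗ v → u -ₑ s ≗ v -ₑ s
-ₑ-cong s u≗v k = cong (_∸ e s k) (u≗v k)

+ₑ-ₑ-cancel : (u : Fin n → ℕ) (i : Fin n) → u +ₑ i -ₑ i ≗ u
+ₑ-ₑ-cancel u i k = m+n∸n≡m (u k) (e i k)

-ₑ+ₑ-cancel : (u : Fin n → ℕ) (s : Fin n) → 1 ≤ u s → u -ₑ s +ₑ s ≗ u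
-ₑ+ₑ-cancel u s 1≤us k = m∸n+n≡m (es≤u k)
  where
  es≤u : ∀ k → e s k ≤ u k
  es≤u k with k ≟ s
  ... | yes refl = 1≤us
  ... | no _     = z≤n

+ₑ-comm : (u : Fin n → ℕ) (i j : Fin n) → u +ₑ i +ₑ j ≗ u +ₑ j +ₑ i
+ₑ-comm u i j k = trans (+-assoc (u k) (e i k) (e j k))
  (trans (cong (u k +_) (+-comm (e i k) (e j k))) (sym (+-assoc (u k) (e j k) (e i k))))

-ₑ+ₑ-comm : (u : Fin n → ℕ) {i s : Fin n} → i ≢ s → u -ₑ s +ₑ i ≗ u +ₑ i -ₑ s
-ₑ+ₑ-comm u {i} {s} i≢s k with k ≟ s
... | yes refl rewrite e-other {s = i} (i≢s ∘ sym) =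
  trans (+-identityʳ (u k ∸ 1)) (cong (_∸ 1) (sym (+-identityʳ (u k))))
... | no _     = refl

+ₑ-ₑ+ₑ-comm : (u : Fin n → ℕ) {i j s : Fin n} → i ≢ s → j ≢ s → u +ₑ j -ₑ s +ₑ i ≗ u +ₑ i -ₑ s +ₑ j
+ₑ-ₑ+ₑ-comm u {i} {j} {s} i≢s j≢s k = begin
  (u +ₑ j -ₑ s +ₑ i) k ≡⟨ -ₑ+ₑ-comm (u +ₑ j) i≢s k ⟩
  (u +ₑ j +ₑ i -ₑ s) k ≡⟨ -ₑ-cong s (+ₑ-comm u j i) k ⟩
  (u +ₑ i +ₑ j -ₑ s) k ≡⟨ -ₑ+ₑ-comm (u +ₑ i) j≢s k ⟨
  (u +ₑ i -ₑ s +ₑ j) k ∎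
  where open ≡-Reasoning

≤ᵥ-refl : u ≤ᵥ u
≤ᵥ-refl k = ≤-refl

≤ᵥ-reflexive : u ≗ v → u ≤ᵥ v
≤ᵥ-reflexive u≗v k = ≤-reflexive (u≗v k)

≤ᵥ-trans : u ≤ᵥ v → v ≤ᵥ w → u ≤ᵥ w
≤ᵥ-trans u≤v v≤w k = ≤-trans (u≤v k) (v≤w k)

≤ᵥ-+ₑ : (u : Fin n → ℕ) (i : Fin n) → u ≤ᵥ u +ₑ i
≤ᵥ-+ₑ u i k = m≤m+n (u k) (e i k)

-ₑ-≤ᵥ : (u : Fin n → ℕ) (s : Fin n) → u -ₑ s ≤ᵥ u
-ₑ-≤ᵥ u s k = m∸n≤m (u k) (e s k)

+ₑ-mono : (i : Fin n) → u ≤ᵥ v → u +ₑ i ≤ᵥ v +ₑ i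
+ₑ-mono i u≤v k = +-monoˡ-≤ (e i k) (u≤v k)

-ₑ-mono : (s : Fin n) → u ≤ᵥ v → u -ₑ s ≤ᵥ v -ₑ s
-ₑ-mono s u≤v k = ∸-monoˡ-≤ (e s k) (u≤v k)

-ₑ+ₑ-mono : (s t : Fin n) → u ≤ᵥ v → u -ₑ s +ₑ t ≤ᵥ v -ₑ s +ₑ t
-ₑ+ₑ-mono s t u≤v = +ₑ-mono t (-ₑ-mono s u≤v)

+ₑ-least : u ≤ᵥ v → u i < v i → u +ₑ i ≤ᵥ v
+ₑ-least {u = u} {v} {i} u≤v ui<vi k = case k ≟ i of λ where
  (yes refl) → subst (_≤ v k) (sym (+ₑ-self u k)) ui<vi
  (no k≢i)   → subst (_≤ v k) (sym (+ₑ-other u k≢i)) (u≤v k)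

∣∣-cong : u ≗ v → ∣ u ∣ ≡ ∣ v ∣
∣∣-cong {zero}  u≗v = refl
∣∣-cong {suc n} {u = u} {v} u≗v =
  cong₂ _+_ (u≗v Fin.zero) (∣∣-cong {u = u ∘ Fin.suc} {v ∘ Fin.suc} (u≗v ∘ Fin.suc))

∣∣-mono : u ≤ᵥ v → ∣ u ∣ ≤ ∣ v ∣
∣∣-mono {zero}  u≤v = z≤n
∣∣-mono {suc n} {u = u} {v} u≤v =
  +-mono-≤ (u≤v Fin.zero) (∣∣-mono {u = u ∘ Fin.suc} {v ∘ Fin.suc} (u≤v ∘ Fin.suc))

∣∣-mono-< : u ≤ᵥ v → u i < v i → ∣ u ∣ < ∣ v ∣
∣∣-mono-< {suc n} {u = u} {v} {Fin.zero}  u≤v ui<vi =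
  +-mono-<-≤ ui<vi (∣∣-mono {u = u ∘ Fin.suc} {v ∘ Fin.suc} (u≤v ∘ Fin.suc))
∣∣-mono-< {suc n} {u = u} {v} {Fin.suc i} u≤v ui<vi =
  +-mono-≤-< (u≤v Fin.zero) (∣∣-mono-< {u = u ∘ Fin.suc} {v ∘ Fin.suc} {i} (u≤v ∘ Fin.suc) ui<vi)

≤ᵥ∧∣∣≡⇒≥ᵥ : u ≤ᵥ v → ∣ u ∣ ≡ ∣ v ∣ → v ≤ᵥ u
≤ᵥ∧∣∣≡⇒≥ᵥ {u = u} {v} u≤v ∣u∣≡∣v∣ k with u k <? v k
... | yes uk<vk = contradiction ∣u∣≡∣v∣ (<⇒≢ (∣∣-mono-< u≤v uk<vk))
... | no uk≮vk  = ≮⇒≥ uk≮vk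

∣∣-<⇒∃< : ∣ u ∣ < ∣ v ∣ → ∃[ k ] u k < v k
∣∣-<⇒∃< {u = u} {v} ∣u∣<∣v∣ with FinP.any? (λ k → u k <? v k)
... | yes found = found
... | no none   = contradiction (∣∣-mono (λ k → ≮⇒≥ (λ uk<vk → none (k , uk<vk)))) (<⇒≱ ∣u∣<∣v∣)

∣0∣ : ∣ (λ (_ : Fin n) → 0) ∣ ≡ 0
∣0∣ {zero}  = refl
∣0∣ {suc n} = ∣0∣ {n}

∣e∣ : (i : Fin n) → ∣ e i ∣ ≡ 1
∣e∣ {suc n} Fin.zero    = cong suc (∣0∣ {n})
∣e∣ {suc n} (Fin.suc i) = trans (∣∣-cong (e-suc i)) (∣e∣ i)

∣+∣ : (u v : Fin n → ℕ) → ∣ (λ k → u k + v k) ∣ ≡ ∣ u ∣ + ∣ v ∣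
∣+∣ {zero}  u v = refl
∣+∣ {suc n} u v = trans (cong (u Fin.zero + v Fin.zero +_) (∣+∣ (u ∘ Fin.suc) (v ∘ Fin.suc)))
                        (interchange +-commutativeSemigroup (u Fin.zero) (v Fin.zero) _ _)

∣+ₑ∣ : (u : Fin n → ℕ) (i : Fin n) → ∣ u +ₑ i ∣ ≡ suc ∣ u ∣
∣+ₑ∣ u i = trans (∣+∣ u (e i)) (trans (cong (∣ u ∣ +_) (∣e∣ i)) (+-comm ∣ u ∣ 1))

∣-ₑ+ₑ∣ : ∀ (u : Fin n → ℕ) {s} (t : Fin n) → 1 ≤ u s → ∣ u -ₑ s +ₑ t ∣ ≡ ∣ u ∣
∣-ₑ+ₑ∣ u {s} t 1≤us = begin
  ∣ u -ₑ s +ₑ t ∣ ≡⟨ ∣+ₑ∣ (u -ₑ s) t ⟩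
  suc ∣ u -ₑ s ∣  ≡⟨ ∣+ₑ∣ (u -ₑ s) s ⟨
  ∣ u -ₑ s +ₑ s ∣ ≡⟨ ∣∣-cong (-ₑ+ₑ-cancel u s 1≤us) ⟩
  ∣ u ∣           ∎
  where open ≡-Reasoning

∣+ₑ∣≤ : ∀ {r} (u : Fin n → ℕ) (i : Fin n) → ∣ u ∣ < r → ∣ u +ₑ i ∣ ≤ r
∣+ₑ∣≤ u i ∣u∣<r = subst (_≤ _) (sym (∣+ₑ∣ u i)) ∣u∣<r

∣-ₑ+ₑ∣≤ : ∀ {r} (u : Fin n → ℕ) {s} (t : Fin n) → 1 ≤ u s → ∣ u ∣ ≤ r → ∣ u -ₑ s +ₑ t ∣ ≤ r
∣-ₑ+ₑ∣≤ u t 1≤us ∣u∣≤r = subst (_≤ _) (sym (∣-ₑ+ₑ∣ u t 1≤us)) ∣u∣≤r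

∣∣-≤⇒∃< : ∣ u ∣ ≤ ∣ v ∣ → v s < u s → ∃[ t ] u t < v t
∣∣-≤⇒∃< {u = u} {v} {s} ∣u∣≤∣v∣ vs<us
  with ∣∣-<⇒∃< {u = u} {v +ₑ s} (subst (∣ u ∣ <_) (sym (∣+ₑ∣ v s)) (s≤s ∣u∣≤∣v∣))
... | t , ut<vt+et = case t ≟ s of λ where
  (yes refl) → contradiction (≤-pred (subst (u t <_) (+ₑ-self v t) ut<vt+et)) (<⇒≱ vs<us)
  (no t≢s)   → t , subst (u t <_) (+ₑ-other v t≢s) ut<vt+et

restrictQ : ∀ {q n} → (Fin (q + n) → ℕ) → (Fin q → ℕ)
restrictQ {q} {n} α a = α (a ↑ˡ n)

∣∣-split : ∀ q {n} (α : Fin (q + n) → ℕ) → ∣ α ∣ ≡ ∣ restrictQ {q} α ∣ + ∣ restrictE {q} α ∣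
∣∣-split zero    α = refl
∣∣-split (suc q) α = trans (cong (α Fin.zero +_) (∣∣-split q (α ∘ Fin.suc)))
                           (sym (+-assoc (α Fin.zero) _ _))

∣restrictE∣≤∣∣ : ∀ q {n} (α : Fin (q + n) → ℕ) → ∣ restrictE {q} α ∣ ≤ ∣ α ∣
∣restrictE∣≤∣∣ q α = subst (∣ restrictE {q} α ∣ ≤_) (sym (∣∣-split q α)) (m≤n+m _ ∣ restrictQ {q} α ∣)

↑ˡ⊎↑ʳ : ∀ q {n} (i : Fin (q + n)) → (∃[ a ] a ↑ˡ n ≡ i) ⊎ (∃[ b ] q ↑ʳ b ≡ i)
↑ˡ⊎↑ʳ q i with splitAt q i in eq
... | inj₁ a = inj₁ (a , FinP.splitAt⁻¹-↑ˡ eq)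
... | inj₂ b = inj₂ (b , FinP.splitAt⁻¹-↑ʳ eq)

↑ʳ≢↑ˡ : ∀ q {n} (k : Fin n) (a : Fin q) → q ↑ʳ k ≢ a ↑ˡ n
↑ʳ≢↑ˡ q {n} k a eq
  with () ← trans (sym (FinP.splitAt-↑ʳ q n k)) (trans (cong (splitAt q) eq) (FinP.splitAt-↑ˡ q a n))

e-↑ʳ : ∀ q {n} (s k : Fin n) → e (q ↑ʳ s) (q ↑ʳ k) ≡ e s k
e-↑ʳ q s k = case k ≟ s of λ where
  (yes refl) → trans (e-same (q ↑ʳ s)) (sym (e-same s))
  (no k≢s)   → trans (e-other (k≢s ∘ FinP.↑ʳ-injective q k s)) (sym (e-other k≢s))

e-↑ˡ : ∀ q {n} (a : Fin q) (k : Fin n) → e (a ↑ˡ n) (q ↑ʳ k) ≡ 0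
e-↑ˡ q a k = e-other (↑ʳ≢↑ˡ q k a)

module _ {q n : ℕ} (α : Fin (q + n) → ℕ) where
  restrictE-+ₑ↑ʳ : (t : Fin n) → restrictE {q} (α +ₑ (q ↑ʳ t)) ≗ restrictE α +ₑ t
  restrictE-+ₑ↑ʳ t k = cong (α (q ↑ʳ k) +_) (e-↑ʳ q t k)

  restrictE--ₑ↑ʳ : (s : Fin n) → restrictE {q} (α -ₑ (q ↑ʳ s)) ≗ restrictE α -ₑ s
  restrictE--ₑ↑ʳ s k = cong (α (q ↑ʳ k) ∸_) (e-↑ʳ q s k)

  restrictE-+ₑ↑ˡ : (a : Fin q) → restrictE {q} (α +ₑ (a ↑ˡ n)) ≗ restrictE α
  restrictE-+ₑ↑ˡ a k = trans (cong (α (q ↑ʳ k) +_) (e-↑ˡ q a k)) (+-identityʳ _)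

  restrictE--ₑ↑ˡ : (a : Fin q) → restrictE {q} (α -ₑ (a ↑ˡ n)) ≗ restrictE α
  restrictE--ₑ↑ˡ a k = cong (α (q ↑ʳ k) ∸_) (e-↑ˡ q a k)

module _ {q n : ℕ} (u : Fin q → ℕ) (v : Fin n → ℕ) where
  restrictQ-++ : restrictQ {q} (u ++ v) ≗ u
  restrictQ-++ a rewrite FinP.splitAt-↑ˡ q a n = refl

  restrictE-++ : restrictE {q} (u ++ v) ≗ v
  restrictE-++ k rewrite FinP.splitAt-↑ʳ q n k = refl

  ∣++∣ : ∣ u ++ v ∣ ≡ ∣ u ∣ + ∣ v ∣
  ∣++∣ = trans (∣∣-split q (u ++ v)) (cong₂ _+_ (∣∣-cong restrictQ-++) (∣∣-cong restrictE-++))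

module ExtendedOrder {c ℓ₁ ℓ₂} (Γ : TotallyOrderedAbelianGroup c ℓ₁ ℓ₂) where
  open TotallyOrderedAbelianGroup Γ using (_∙_; _≤_; isTotalOrder; ≤-translate; comm)
  open Extended Γ

  private
    module ≤ = IsTotalOrder isTotalOrder

    ≤ᴳ-poset : Poset c ℓ₁ ℓ₂
    ≤ᴳ-poset = record { isPartialOrder = ≤.isPartialOrder }

  ≤̄-refl : ∀ {a} → a ≤̄ a
  ≤̄-refl {fin a} = fin≤fin ≤.refl
  ≤̄-refl {∞}     = ∞ ≤∞

  infixr 4 _⟨≤̄⟩_
  _⟨≤̄⟩_ : ∀ {a b d} → a ≤̄ b → b ≤̄ d → a ≤̄ d
  fin≤fin a≤b ⟨≤̄⟩ fin≤fin b≤d = fin≤fin (≤.trans a≤b b≤d)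
  _           ⟨≤̄⟩ (_ ≤∞)      = _ ≤∞

  ≈̄⇒≥̄ : ∀ {a b} → a ≈̄ b → b ≤̄ a
  ≈̄⇒≥̄ (fin≈fin a≈b) = fin≤fin (≤.reflexive (≤.Eq.sym a≈b))
  ≈̄⇒≥̄ ∞≈∞           = ∞ ≤∞

  ∞≤̄⇒≡∞ : ∀ {a} → ∞ ≤̄ a → a ≡ ∞
  ∞≤̄⇒≡∞ (_ ≤∞) = refl

  +̄-mono : ∀ {a a′ b b′} → a ≤̄ a′ → b ≤̄ b′ → a +̄ b ≤̄ a′ +̄ b′
  +̄-mono (fin≤fin {a} {a′} a≤a′) (fin≤fin {b} {b′} b≤b′) = fin≤fin (begin
    a ∙ b    ≤⟨ ≤-translate a a′ b a≤a′ ⟩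
    a′ ∙ b   ≈⟨ comm a′ b ⟩
    b ∙ a′   ≤⟨ ≤-translate b b′ a′ b≤b′ ⟩
    b′ ∙ a′  ≈⟨ comm b′ a′ ⟩
    a′ ∙ b′  ∎)
    where open import Relation.Binary.Reasoning.PartialOrder ≤ᴳ-poset
  +̄-mono (fin≤fin _) (_ ≤∞) = _ ≤∞
  +̄-mono (_ ≤∞)      _      = _ ≤∞

  +̄-monoˡ : ∀ {a a′ b} → a ≤̄ a′ → a +̄ b ≤̄ a′ +̄ b
  +̄-monoˡ a≤a′ = +̄-mono a≤a′ ≤̄-refl

  +̄-monoʳ : ∀ {a b b′} → b ≤̄ b′ → a +̄ b ≤̄ a +̄ b′
  +̄-monoʳ b≤b′ = +̄-mono ≤̄-refl b≤b′

module M♮Convexity {c ℓ₁ ℓ₂} (Γ : TotallyOrderedAbelianGroup c ℓ₁ ℓ₂) where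
  open Extended Γ
  open ExtendedOrder Γ

  SwapAt : ((Fin n → ℕ) → Γ̄) → (x y : Fin n → ℕ) → Fin n → Set (c ⊔ ℓ₂)
  SwapAt g x y s = ∃[ t ] x t < y t × g (x -ₑ s +ₑ t) +̄ g (y -ₑ t +ₑ s) ≤̄ g x +̄ g y

  ExchangeAt : ((Fin n → ℕ) → Γ̄) → (x y : Fin n → ℕ) → Fin n → Set (c ⊔ ℓ₂)
  ExchangeAt g x y s = SwapAt g x y s ⊎ (∣ y ∣ < ∣ x ∣ × g (x -ₑ s) +̄ g (y +ₑ s) ≤̄ g x +̄ g y)

  ExchangeAtSlack : ((Fin n → ℕ) → Γ̄) → (x y : Fin n → ℕ) → Set (c ⊔ ℓ₂)
  ExchangeAtSlack g x y = ∃[ t ] x t < y t × g (x +ₑ t) +̄ g (y -ₑ t) ≤̄ g x +̄ g y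

  -- M♮-convexity on Δ^{≤ r}, stated as M-convexity of the homogenization
  -- (r ∸ ∣ x ∣ , x) ↦ g x on Δ^r over {slack} ⊔ E: ExchangeAt is the exchange
  -- at s ∈ E (its second alternative is t = slack), ExchangeAtSlack the one at
  -- s = slack.  Functions on Fin n → ℕ need not respect ≗, hence ≗⇒≤̄.
  record IsM♮Convex (r : ℕ) (g : (Fin n → ℕ) → Γ̄) : Set (c ⊔ ℓ₂) where
    field
      ≗⇒≤̄             : u ≗ v → ∣ u ∣ ≤ r → g u ≤̄ g v
      nonempty        : ∃[ x ] ∣ x ∣ ≡ r × g x ≢ ∞
      exchangeAt      : ∣ x ∣ ≤ r → ∣ y ∣ ≤ r → y s < x s → ExchangeAt g x y s
      exchangeAtSlack : ∣ x ∣ < ∣ y ∣ → ∣ y ∣ ≤ r → ExchangeAtSlack g x y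

  module _ {r} {g : (Fin n → ℕ) → Γ̄} (g-convex : IsM♮Convex r g) (q : ℕ) where
    open IsM♮Convex g-convex

    private
      G : (Fin (q + n) → ℕ) → Γ̄
      G = g ∘ restrictE {q}

      MExchangeAt : (α β : Fin (q + n) → ℕ) → Fin (q + n) → Set (c ⊔ ℓ₂)
      MExchangeAt α β s̃ = ∃[ t̃ ] α t̃ < β t̃ × G (α -ₑ s̃ +ₑ t̃) +̄ G (β -ₑ t̃ +ₑ s̃) ≤̄ G α +̄ G β

      ∣restrictE∣≤r : {α : Fin (q + n) → ℕ} → ∣ α ∣ ≡ r → ∣ restrictE {q} α ∣ ≤ r
      ∣restrictE∣≤r {α} ∣α∣ = ≤-trans (∣restrictE∣≤∣∣ q α) (≤-reflexive ∣α∣)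

      slack-sizes : {α β : Fin (q + n) → ℕ} → ∣ α ∣ ≡ r → ∣ β ∣ ≡ r →
                    ∣ restrictQ {q} α ∣ + ∣ restrictE {q} α ∣ ≡ ∣ restrictQ {q} β ∣ + ∣ restrictE {q} β ∣
      slack-sizes {α} {β} ∣α∣ ∣β∣ = trans (sym (∣∣-split q α)) (trans ∣α∣ (trans (sym ∣β∣) (∣∣-split q β)))

      transfer : ∀ {α β s̃ t̃ u v} → ∣ α ∣ ≡ r → ∣ β ∣ ≡ r → 1 ≤ α s̃ → 1 ≤ β t̃ →
                 restrictE (α -ₑ s̃ +ₑ t̃) ≗ u → restrictE (β -ₑ t̃ +ₑ s̃) ≗ v →
                 g u +̄ g v ≤̄ G α +̄ G β → G (α -ₑ s̃ +ₑ t̃) +̄ G (β -ₑ t̃ +ₑ s̃) ≤̄ G α +̄ G β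
      transfer {α} {β} {s̃} {t̃} ∣α∣ ∣β∣ 1≤αs 1≤βt α≗u β≗v gu+gv≤ =
        +̄-mono (≗⇒≤̄ α≗u (∣restrictE∣≤r (trans (∣-ₑ+ₑ∣ α t̃ 1≤αs) ∣α∣)))
               (≗⇒≤̄ β≗v (∣restrictE∣≤r (trans (∣-ₑ+ₑ∣ β s̃ 1≤βt) ∣β∣)))
        ⟨≤̄⟩ gu+gv≤

      exchange-↑ˡ : ∀ {α β : Fin (q + n) → ℕ} a → ∣ α ∣ ≡ r → ∣ β ∣ ≡ r →
                    β (a ↑ˡ n) < α (a ↑ˡ n) → MExchangeAt α β (a ↑ˡ n)
      exchange-↑ˡ {α} {β} a ∣α∣ ∣β∣ βa<αa with ∣ restrictE {q} α ∣ <? ∣ restrictE {q} β ∣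
      ... | yes ∣x∣<∣y∣ =
        let t , xt<yt , R = exchangeAtSlack ∣x∣<∣y∣ (∣restrictE∣≤r ∣β∣)
        in  q ↑ʳ t , xt<yt ,
            transfer ∣α∣ ∣β∣ (m<n⇒0<n βa<αa) (m<n⇒0<n xt<yt)
              (λ k → trans (restrictE-+ₑ↑ʳ (α -ₑ (a ↑ˡ n)) t k) (+ₑ-cong t (restrictE--ₑ↑ˡ α a) k))
              (λ k → trans (restrictE-+ₑ↑ˡ (β -ₑ (q ↑ʳ t)) a k) (restrictE--ₑ↑ʳ β t k))
              R
      ... | no ∣x∣≮∣y∣ =
        let t , αt<βt = ∣∣-≤⇒∃< (complement-≤ (slack-sizes ∣α∣ ∣β∣) (≮⇒≥ ∣x∣≮∣y∣)) βa<αa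
        in  t ↑ˡ n , αt<βt ,
            transfer ∣α∣ ∣β∣ (m<n⇒0<n βa<αa) (m<n⇒0<n αt<βt)
              (λ k → trans (restrictE-+ₑ↑ˡ (α -ₑ (a ↑ˡ n)) t k) (restrictE--ₑ↑ˡ α a k))
              (λ k → trans (restrictE-+ₑ↑ˡ (β -ₑ (t ↑ˡ n)) a k) (restrictE--ₑ↑ˡ β t k))
              ≤̄-refl

      exchange-↑ʳ : ∀ {α β : Fin (q + n) → ℕ} s → ∣ α ∣ ≡ r → ∣ β ∣ ≡ r →
                    β (q ↑ʳ s) < α (q ↑ʳ s) → MExchangeAt α β (q ↑ʳ s)
      exchange-↑ʳ {α} {β} s ∣α∣ ∣β∣ βs<αs with exchangeAt (∣restrictE∣≤r ∣α∣) (∣restrictE∣≤r ∣β∣) βs<αs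
      ... | inj₁ (t , xt<yt , R) =
        q ↑ʳ t , xt<yt ,
        transfer ∣α∣ ∣β∣ (m<n⇒0<n βs<αs) (m<n⇒0<n xt<yt)
          (λ k → trans (restrictE-+ₑ↑ʳ (α -ₑ (q ↑ʳ s)) t k) (+ₑ-cong t (restrictE--ₑ↑ʳ α s) k))
          (λ k → trans (restrictE-+ₑ↑ʳ (β -ₑ (q ↑ʳ t)) s k) (+ₑ-cong s (restrictE--ₑ↑ʳ β t) k))
          R
      ... | inj₂ (∣y∣<∣x∣ , R) =
        let t , αt<βt = ∣∣-<⇒∃< (complement-< (slack-sizes ∣α∣ ∣β∣) ∣y∣<∣x∣)
        in  t ↑ˡ n , αt<βt ,
            transfer ∣α∣ ∣β∣ (m<n⇒0<n βs<αs) (m<n⇒0<n αt<βt)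
              (λ k → trans (restrictE-+ₑ↑ˡ (α -ₑ (q ↑ʳ s)) t k) (restrictE--ₑ↑ʳ α s k))
              (λ k → trans (restrictE-+ₑ↑ʳ (β -ₑ (t ↑ˡ n)) s k) (+ₑ-cong s (restrictE--ₑ↑ˡ β t) k))
              R

    IsM♮Convex⇒IsMConvex-restrictE : IsMConvex Γ {q + n} r G
    IsM♮Convex⇒IsMConvex-restrictE = padded , exchange
      where
      padded : ∃[ α ] ∣ α ∣ ≡ r × G α ≢ ∞
      padded =
        let x , ∣x∣ , gx≢∞ = nonempty
            ∣0++x∣ = trans (∣++∣ zeros x) (trans (cong (_+ ∣ x ∣) (∣0∣ {q})) ∣x∣)
        in  zeros ++ x , ∣0++x∣ , λ G≡∞ →
              gx≢∞ (∞≤̄⇒≡∞ (subst (_≤̄ g x) G≡∞ (≗⇒≤̄ (restrictE-++ zeros x) (∣restrictE∣≤r ∣0++x∣))))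
        where
        zeros : Fin q → ℕ
        zeros _ = 0

      exchange : ∀ α β → ∣ α ∣ ≡ r → ∣ β ∣ ≡ r → ∀ s̃ → β s̃ < α s̃ → MExchangeAt α β s̃
      exchange α β ∣α∣ ∣β∣ s̃ βs<αs with ↑ˡ⊎↑ʳ q s̃
      ... | inj₁ (a , refl) = exchange-↑ˡ a ∣α∣ ∣β∣ βs<αs
      ... | inj₂ (s , refl) = exchange-↑ʳ s ∣α∣ ∣β∣ βs<αs

module MinExtension {c ℓ₁ ℓ₂} (Γ : TotallyOrderedAbelianGroup c ℓ₁ ℓ₂) {n} (r : ℕ)
  (ν ν̃ : (Fin n → ℕ) → Extended.Γ̄ Γ) (ν-convex : IsMConvex Γ r ν) (ν̃-min : IsMinExtension Γ r ν ν̃)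
  where
  open Extended Γ
  open ExtendedOrder Γ
  open M♮Convexity Γ

  ν̃≤ν : ∀ {V} → u ≤ᵥ V → ∣ V ∣ ≡ r → ν̃ u ≤̄ ν V
  ν̃≤ν {u} u≤V ∣V∣ = proj₂ (ν̃-min u (≤-trans (∣∣-mono u≤V) (≤-reflexive ∣V∣))) _ ∣V∣ u≤V

  ν̃-mono : u ≤ᵥ v → ∣ v ∣ ≤ r → ν̃ u ≤̄ ν̃ v
  ν̃-mono {v = v} u≤v ∣v∣≤r =
    let V , ∣V∣ , v≤V , ν̃v≈νV = proj₁ (ν̃-min v ∣v∣≤r)
    in  ν̃≤ν (≤ᵥ-trans u≤v v≤V) ∣V∣ ⟨≤̄⟩ ≈̄⇒≥̄ ν̃v≈νV

  ν̃-mono₂ : u ≤ᵥ u′ → v ≤ᵥ v′ → ∣ u′ ∣ ≤ r → ∣ v′ ∣ ≤ r → ν̃ u +̄ ν̃ v ≤̄ ν̃ u′ +̄ ν̃ v′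
  ν̃-mono₂ u≤u′ v≤v′ ∣u′∣≤r ∣v′∣≤r = +̄-mono (ν̃-mono u≤u′ ∣u′∣≤r) (ν̃-mono v≤v′ ∣v′∣≤r)

  -- Raise x towards one of its minimizers.
  ν̃-fill : ∣ x ∣ < r → ∃[ i ] ν̃ (x +ₑ i) ≤̄ ν̃ x
  ν̃-fill {x} ∣x∣<r =
    let X , ∣X∣ , x≤X , ν̃x≈νX = proj₁ (ν̃-min x (<⇒≤ ∣x∣<r))
        i , xi<Xi = ∣∣-<⇒∃< (subst (∣ x ∣ <_) (sym ∣X∣) ∣x∣<r)
    in  i , ν̃≤ν (+ₑ-least x≤X xi<Xi) ∣X∣ ⟨≤̄⟩ ≈̄⇒≥̄ ν̃x≈νX

  common-fill : ∀ {A B c} → x +ₑ c ≤ᵥ A → y ≤ᵥ B → ∣ A ∣ ≤ r → ∣ B ∣ ≤ r →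
                ν̃ (y +ₑ c) ≤̄ ν̃ y → ν̃ A +̄ ν̃ B ≤̄ ν̃ x +̄ ν̃ y →
                ν̃ (x +ₑ c) +̄ ν̃ (y +ₑ c) ≤̄ ν̃ x +̄ ν̃ y
  common-fill x+c≤A y≤B ∣A∣≤r ∣B∣≤r fill R =
    +̄-monoʳ fill ⟨≤̄⟩ ν̃-mono₂ x+c≤A y≤B ∣A∣≤r ∣B∣≤r ⟨≤̄⟩ R

  -- A point of rank r is pointwise equal to its minimizer, so ν's exchange applies.
  swapAt-full : ∣ x ∣ ≡ r → ∣ y ∣ ≡ r → y s < x s → SwapAt ν̃ x y s
  swapAt-full {x} {y} {s} ∣x∣ ∣y∣ ys<xs =
    let X , ∣X∣ , x≤X , ν̃x≈νX = proj₁ (ν̃-min x (≤-reflexive ∣x∣))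
        Y , ∣Y∣ , y≤Y , ν̃y≈νY = proj₁ (ν̃-min y (≤-reflexive ∣y∣))
        Y≤y = ≤ᵥ∧∣∣≡⇒≥ᵥ y≤Y (trans ∣y∣ (sym ∣Y∣))
        Ys<Xs = ≤-<-trans (Y≤y s) (<-≤-trans ys<xs (x≤X s))
        t , Xt<Yt , R = proj₂ ν-convex X Y ∣X∣ ∣Y∣ s Ys<Xs
    in  t , <-≤-trans (≤-<-trans (x≤X t) Xt<Yt) (Y≤y t) ,
        +̄-mono (ν̃≤ν (-ₑ+ₑ-mono s t x≤X) (trans (∣-ₑ+ₑ∣ X t (m<n⇒0<n Ys<Xs)) ∣X∣))
               (ν̃≤ν (-ₑ+ₑ-mono t s y≤Y) (trans (∣-ₑ+ₑ∣ Y s (m<n⇒0<n Xt<Yt)) ∣Y∣))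
        ⟨≤̄⟩ R ⟨≤̄⟩ +̄-mono (≈̄⇒≥̄ ν̃x≈νX) (≈̄⇒≥̄ ν̃y≈νY)

  -- The recursion is on 2r ∸ (∣ x ∣ + ∣ y ∣), which every recursive call decreases.
  Fuel : ℕ → (x y : Fin n → ℕ) → Set
  Fuel m x y = r + r < ∣ x ∣ + ∣ y ∣ + m

  no-fuel : Fuel 0 x y → ∣ x ∣ ≤ r → ∣ y ∣ ≤ r → ⊥
  no-fuel fuel ∣x∣≤r ∣y∣≤r = <⇒≱ (subst (r + r <_) (+-identityʳ _) fuel) (+-mono-≤ ∣x∣≤r ∣y∣≤r)

  refuel : Fuel (suc m) x y → ∣ x ∣ + ∣ y ∣ < ∣ u ∣ + ∣ v ∣ → Fuel m u v
  refuel {m} {x} {y} fuel grows =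
    <-≤-trans fuel (≤-trans (≤-reflexive (+-suc (∣ x ∣ + ∣ y ∣) m)) (+-monoˡ-≤ m grows))

  refuelˡ : ∀ i → Fuel (suc m) x y → Fuel m (x +ₑ i) y
  refuelˡ {x = x} {y} i fuel = refuel fuel (≤-reflexive (cong (_+ ∣ y ∣) (sym (∣+ₑ∣ x i))))

  refuelʳ : ∀ j → Fuel (suc m) x y → Fuel m x (y +ₑ j)
  refuelʳ {x = x} {y} j fuel =
    refuel fuel (≤-reflexive (trans (sym (+-suc ∣ x ∣ ∣ y ∣)) (cong (∣ x ∣ +_) (sym (∣+ₑ∣ y j)))))

  refuel₂ : Fuel (suc m) x y → ∣ u ∣ ≡ suc ∣ x ∣ → ∣ v ∣ ≡ suc ∣ y ∣ → Fuel m u v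
  refuel₂ fuel ∣u∣ ∣v∣ =
    refuel fuel (subst₂ (λ a b → _ < a + b) (sym ∣u∣) (sym ∣v∣) (+-mono-<-≤ (n<1+n _) (n≤1+n _)))

  record Exchanges (m : ℕ) : Set (c ⊔ ℓ₂) where
    field
      at      : Fuel m x y → ∣ x ∣ ≤ r → ∣ y ∣ ≤ r → y s < x s → ExchangeAt ν̃ x y s
      atSlack : Fuel m x y → ∣ x ∣ < ∣ y ∣ → ∣ y ∣ ≤ r → ExchangeAtSlack ν̃ x y

    swapAt-≤ : Fuel m x y → ∣ x ∣ ≤ ∣ y ∣ → ∣ y ∣ ≤ r → y s < x s → SwapAt ν̃ x y s
    swapAt-≤ fuel ∣x∣≤∣y∣ ∣y∣≤r ys<xs with at fuel (≤-trans ∣x∣≤∣y∣ ∣y∣≤r) ∣y∣≤r ys<xs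
    ... | inj₁ swap          = swap
    ... | inj₂ (∣y∣<∣x∣ , _) = contradiction ∣y∣<∣x∣ (≤⇒≯ ∣x∣≤∣y∣)

  module Step {m} (ih : Exchanges m) where
    open Exchanges ih

    exchangeAtSlack-< : Fuel (suc m) x y → ∣ x ∣ < ∣ y ∣ → ∣ y ∣ ≤ r → ExchangeAtSlack ν̃ x y
    exchangeAtSlack-< {x} {y} fuel ∣x∣<∣y∣ ∣y∣≤r with ν̃-fill (<-≤-trans ∣x∣<∣y∣ ∣y∣≤r)
    ... | i , fill with x i <? y i
    ...   | yes xi<yi = i , xi<yi , +̄-mono fill (ν̃-mono (-ₑ-≤ᵥ y i) ∣y∣≤r)
    ...   | no xi≮yi
      with swapAt-≤ (refuelˡ i fuel) (∣+ₑ∣≤ x i ∣x∣<∣y∣) ∣y∣≤r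
                    (subst (y i <_) (sym (+ₑ-self x i)) (s≤s (≮⇒≥ xi≮yi)))
    ...     | t , x+i<y , R =
      t , ≤-<-trans (≤ᵥ-+ₑ x i t) x+i<y ,
      ν̃-mono₂ (+ₑ-mono t (≤ᵥ-reflexive (sym ∘ +ₑ-ₑ-cancel x i))) (≤ᵥ-+ₑ (y -ₑ t) i)
              (∣-ₑ+ₑ∣≤ (x +ₑ i) t (0<+ₑ-self x i) (∣+ₑ∣≤ x i (<-≤-trans ∣x∣<∣y∣ ∣y∣≤r)))
              (∣-ₑ+ₑ∣≤ y i (m<n⇒0<n x+i<y) ∣y∣≤r)
      ⟨≤̄⟩ R ⟨≤̄⟩ +̄-monoˡ fill

    swapAt-< : Fuel (suc m) x y → ∣ x ∣ < ∣ y ∣ → ∣ y ∣ ≤ r → y s < x s → SwapAt ν̃ x y s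
    swapAt-< {x} {y} {s} fuel ∣x∣<∣y∣ ∣y∣≤r ys<xs with ν̃-fill (<-≤-trans ∣x∣<∣y∣ ∣y∣≤r)
    ... | i , fill with swapAt-≤ (refuelˡ i fuel) (∣+ₑ∣≤ x i ∣x∣<∣y∣) ∣y∣≤r ys<x+is
      where ys<x+is = <-≤-trans ys<xs (≤ᵥ-+ₑ x i s)
    ...   | t , x+i<y , R =
      t , ≤-<-trans (≤ᵥ-+ₑ x i t) x+i<y ,
      +̄-monoˡ (ν̃-mono (-ₑ+ₑ-mono s t (≤ᵥ-+ₑ x i))
                       (∣-ₑ+ₑ∣≤ (x +ₑ i) t (m<n⇒0<n (<-≤-trans ys<xs (≤ᵥ-+ₑ x i s)))
                                (∣+ₑ∣≤ x i (<-≤-trans ∣x∣<∣y∣ ∣y∣≤r))))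
      ⟨≤̄⟩ R ⟨≤̄⟩ +̄-monoˡ fill

    exchangeAt-> : Fuel (suc m) x y → ∣ y ∣ < ∣ x ∣ → ∣ x ∣ ≤ r → y s < x s → ExchangeAt ν̃ x y s
    exchangeAt-> {x} {y} {s} fuel ∣y∣<∣x∣ ∣x∣≤r ys<xs with ν̃-fill (<-≤-trans ∣y∣<∣x∣ ∣x∣≤r)
    ... | j , fill with j ≟ s
    ...   | yes refl = inj₂ (∣y∣<∣x∣ , +̄-monoˡ (ν̃-mono (-ₑ-≤ᵥ x s) ∣x∣≤r) ⟨≤̄⟩ +̄-monoʳ fill)
    ...   | no j≢s =
      case at (refuelʳ j fuel) ∣x∣≤r ∣y+j∣≤r (subst (_< x s) (sym (+ₑ-other y (j≢s ∘ sym))) ys<xs) of λ where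
        (inj₂ (∣y+j∣<∣x∣ , R)) → inj₂ (∣y∣<∣x∣ ,
          +̄-monoʳ (ν̃-mono (+ₑ-mono s (≤ᵥ-+ₑ y j)) (∣+ₑ∣≤ (y +ₑ j) s (<-≤-trans ∣y+j∣<∣x∣ ∣x∣≤r)))
          ⟨≤̄⟩ R ⟨≤̄⟩ +̄-monoʳ fill)
        (inj₁ (t , xt<y+j , R)) → case t ≟ j of λ where
          (yes refl) → inj₂ (∣y∣<∣x∣ ,
            ν̃-mono₂ (≤ᵥ-+ₑ (x -ₑ s) t) (+ₑ-mono s (≤ᵥ-reflexive (sym ∘ +ₑ-ₑ-cancel y t)))
                    (∣-ₑ+ₑ∣≤ x t (m<n⇒0<n ys<xs) ∣x∣≤r) (∣-ₑ+ₑ∣≤ (y +ₑ t) s (m<n⇒0<n xt<y+j) ∣y+j∣≤r)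
            ⟨≤̄⟩ R ⟨≤̄⟩ +̄-monoʳ fill)
          (no t≢j) → inj₁ (t , subst (x t <_) (+ₑ-other y t≢j) xt<y+j ,
            +̄-monoʳ (ν̃-mono (-ₑ+ₑ-mono t s (≤ᵥ-+ₑ y j)) (∣-ₑ+ₑ∣≤ (y +ₑ j) s (m<n⇒0<n xt<y+j) ∣y+j∣≤r))
            ⟨≤̄⟩ R ⟨≤̄⟩ +̄-monoʳ fill)
      where
      ∣y+j∣≤r : ∣ y +ₑ j ∣ ≤ r
      ∣y+j∣≤r = ∣+ₑ∣≤ y j (<-≤-trans ∣y∣<∣x∣ ∣x∣≤r)

    -- Raise x at i and y at j.  The exchange of the raised pair descends to
    -- (x, y) unless it uses t = j (crossed); then a second exchange, at i,
    -- either descends (via-pivot) or exhibits one coordinate c raising both x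
    -- and y, and such a common raise always descends (via-common-fill).
    module SameSize {x y s} (fuel : Fuel (suc m) x y) (∣x∣≡∣y∣ : ∣ x ∣ ≡ ∣ y ∣) (∣y∣<r : ∣ y ∣ < r)
                    (ys<xs : y s < x s) where
      ∣x∣<r : ∣ x ∣ < r
      ∣x∣<r = subst (_< r) (sym ∣x∣≡∣y∣) ∣y∣<r

      swapAt-raised : ∀ {u v t} → ∣ u ∣ ≡ suc ∣ x ∣ → ∣ v ∣ ≡ suc ∣ y ∣ → v t < u t → SwapAt ν̃ u v t
      swapAt-raised ∣u∣ ∣v∣ =
        swapAt-≤ (refuel₂ fuel ∣u∣ ∣v∣) (≤-reflexive (trans ∣u∣ (trans (cong suc ∣x∣≡∣y∣) (sym ∣v∣))))
                 (subst (_≤ r) (sym ∣v∣) ∣y∣<r)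

      via-common-fill : ∀ {c} → ν̃ (x +ₑ c) +̄ ν̃ (y +ₑ c) ≤̄ ν̃ x +̄ ν̃ y → SwapAt ν̃ x y s
      via-common-fill {c} P =
        let t , x+c<y+c , R = swapAt-raised (∣+ₑ∣ x c) (∣+ₑ∣ y c) y+c<x+c
        in  t , +-cancelʳ-< (e c t) (x t) (y t) x+c<y+c ,
            ν̃-mono₂ (-ₑ+ₑ-mono s t (≤ᵥ-+ₑ x c)) (-ₑ+ₑ-mono t s (≤ᵥ-+ₑ y c))
                    (∣-ₑ+ₑ∣≤ (x +ₑ c) t (m<n⇒0<n y+c<x+c) (∣+ₑ∣≤ x c ∣x∣<r))
                    (∣-ₑ+ₑ∣≤ (y +ₑ c) s (m<n⇒0<n x+c<y+c) (∣+ₑ∣≤ y c ∣y∣<r))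
            ⟨≤̄⟩ R ⟨≤̄⟩ P
        where
        y+c<x+c : (y +ₑ c) s < (x +ₑ c) s
        y+c<x+c = +-monoˡ-< (e c s) ys<xs

      via-slack : ν̃ (y +ₑ s) ≤̄ ν̃ y → SwapAt ν̃ x y s
      via-slack fill =
        case atSlack (refuelʳ s fuel) ∣x∣<∣y+s∣ (∣+ₑ∣≤ y s ∣y∣<r) of λ where
          (t , xt<y+s , R) → case t ≟ s of λ where
            (yes refl) → contradiction (subst (x t <_) (+ₑ-self y t) xt<y+s) (≤⇒≯ ys<xs)
            (no t≢s)   → t , subst (x t <_) (+ₑ-other y t≢s) xt<y+s ,
              ν̃-mono₂ (+ₑ-mono t (-ₑ-≤ᵥ x s)) (≤ᵥ-reflexive (-ₑ+ₑ-comm y (t≢s ∘ sym)))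
                      (∣+ₑ∣≤ x t ∣x∣<r) (≤-trans (∣∣-mono (-ₑ-≤ᵥ (y +ₑ s) t)) (∣+ₑ∣≤ y s ∣y∣<r))
              ⟨≤̄⟩ R ⟨≤̄⟩ +̄-monoʳ fill
        where
        ∣x∣<∣y+s∣ : ∣ x ∣ < ∣ y +ₑ s ∣
        ∣x∣<∣y+s∣ = subst (∣ x ∣ <_) (sym (∣+ₑ∣ y s)) (s≤s (≤-reflexive ∣x∣≡∣y∣))

      via-pivot : ∀ {i j} → i ≢ s → y i ≤ x i → ν̃ (y +ₑ j) ≤̄ ν̃ y →
                  ν̃ (x +ₑ j -ₑ s +ₑ i) +̄ ν̃ (y +ₑ s) ≤̄ ν̃ x +̄ ν̃ y → SwapAt ν̃ x y s
      via-pivot {i} {j} i≢s yi≤xi fill P = case swapAt-raised ∣a∣ (∣+ₑ∣ y s) bi<ai of λ where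
          (t , at<bt , R) → case t ≟ s of λ where
            (yes refl) → via-common-fill
              (common-fill (≤ᵥ-reflexive λ k → trans (sym (-ₑ+ₑ-cancel (x +ₑ j) s 0<x+js k))
                                                     (+ₑ-cong s (sym ∘ +ₑ-ₑ-cancel (x +ₑ j -ₑ s) i) k))
                           (≤ᵥ-trans (≤ᵥ-reflexive (sym ∘ +ₑ-ₑ-cancel y s)) (≤ᵥ-+ₑ _ i))
                           (∣-ₑ+ₑ∣≤ a t (m<n⇒0<n bi<ai) ∣a∣≤r) (∣-ₑ+ₑ∣≤ b i (m<n⇒0<n at<bt) ∣b∣≤r)
                           fill (R ⟨≤̄⟩ P))
            (no t≢s) → t ,
              <-≤-trans (≤-<-trans (x≤a t≢s) at<bt) (≤-reflexive (+ₑ-other y t≢s)) ,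
              ν̃-mono₂ (+ₑ-mono t (≤ᵥ-trans (-ₑ-mono s (≤ᵥ-+ₑ x j))
                                           (≤ᵥ-reflexive (sym ∘ +ₑ-ₑ-cancel (x +ₑ j -ₑ s) i))))
                      (≤ᵥ-trans (≤ᵥ-reflexive (-ₑ+ₑ-comm y (t≢s ∘ sym))) (≤ᵥ-+ₑ _ i))
                      (∣-ₑ+ₑ∣≤ a t (m<n⇒0<n bi<ai) ∣a∣≤r) (∣-ₑ+ₑ∣≤ b i (m<n⇒0<n at<bt) ∣b∣≤r)
              ⟨≤̄⟩ R ⟨≤̄⟩ P
        where
        a b : Fin n → ℕ
        a = x +ₑ j -ₑ s +ₑ i
        b = y +ₑ s

        0<x+js : 0 < (x +ₑ j) s
        0<x+js = ≤-trans (m<n⇒0<n ys<xs) (≤ᵥ-+ₑ x j s)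

        ∣a∣ : ∣ a ∣ ≡ suc ∣ x ∣
        ∣a∣ = trans (∣-ₑ+ₑ∣ (x +ₑ j) i 0<x+js) (∣+ₑ∣ x j)

        ∣a∣≤r : ∣ a ∣ ≤ r
        ∣a∣≤r = subst (_≤ r) (sym ∣a∣) ∣x∣<r

        ∣b∣≤r : ∣ b ∣ ≤ r
        ∣b∣≤r = ∣+ₑ∣≤ y s ∣y∣<r

        x≤x+j-s : ∀ {k} → k ≢ s → x k ≤ (x +ₑ j -ₑ s) k
        x≤x+j-s {k} k≢s = ≤-trans (≤ᵥ-+ₑ x j k) (≤-reflexive (sym (-ₑ-other (x +ₑ j) k≢s)))

        x≤a : ∀ {k} → k ≢ s → x k ≤ a k
        x≤a {k} k≢s = ≤-trans (x≤x+j-s k≢s) (≤ᵥ-+ₑ (x +ₑ j -ₑ s) i k)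

        bi<ai : b i < a i
        bi<ai = subst₂ _<_ (sym (+ₑ-other y i≢s)) (sym (+ₑ-self (x +ₑ j -ₑ s) i))
                       (s≤s (≤-trans yi≤xi (x≤x+j-s i≢s)))

      crossed : ∀ {i j} → j ≢ s → ν̃ (y +ₑ j) ≤̄ ν̃ y →
                ν̃ (x +ₑ i -ₑ s +ₑ j) +̄ ν̃ (y +ₑ j -ₑ j +ₑ s) ≤̄ ν̃ x +̄ ν̃ y → SwapAt ν̃ x y s
      crossed {i} {j} j≢s fill Q = case i ≟ s of λ where
          (yes refl) → via-common-fill
            (common-fill (+ₑ-mono j (≤ᵥ-reflexive (sym ∘ +ₑ-ₑ-cancel x i))) (≤ᵥ-trans y≤y+j-j (≤ᵥ-+ₑ _ s))
                         ∣A∣≤r ∣B∣≤r fill Q)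
          (no i≢s) → case x i <? y i of λ where
            (yes xi<yi) → i , xi<yi ,
              ν̃-mono₂ (≤ᵥ-trans (≤ᵥ-reflexive (-ₑ+ₑ-comm x i≢s)) (≤ᵥ-+ₑ _ j))
                      (+ₑ-mono s (≤ᵥ-trans (-ₑ-≤ᵥ y i) y≤y+j-j)) ∣A∣≤r ∣B∣≤r
              ⟨≤̄⟩ Q
            (no xi≮yi) → via-pivot i≢s (≮⇒≥ xi≮yi) fill
              (ν̃-mono₂ (≤ᵥ-reflexive (+ₑ-ₑ+ₑ-comm x i≢s j≢s)) (+ₑ-mono s y≤y+j-j) ∣A∣≤r ∣B∣≤r ⟨≤̄⟩ Q)
        where
        ∣A∣≤r : ∣ x +ₑ i -ₑ s +ₑ j ∣ ≤ r
        ∣A∣≤r = ∣-ₑ+ₑ∣≤ (x +ₑ i) j (≤-trans (m<n⇒0<n ys<xs) (≤ᵥ-+ₑ x i s)) (∣+ₑ∣≤ x i ∣x∣<r)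

        ∣B∣≤r : ∣ y +ₑ j -ₑ j +ₑ s ∣ ≤ r
        ∣B∣≤r = ∣-ₑ+ₑ∣≤ (y +ₑ j) s (0<+ₑ-self y j) (∣+ₑ∣≤ y j ∣y∣<r)

        y≤y+j-j : y ≤ᵥ y +ₑ j -ₑ j
        y≤y+j-j = ≤ᵥ-reflexive (sym ∘ +ₑ-ₑ-cancel y j)

      swapAt-≡ : SwapAt ν̃ x y s
      swapAt-≡ with ν̃-fill ∣x∣<r | ν̃-fill ∣y∣<r
      ... | i , fillx | j , filly with j ≟ s
      ...   | yes refl = via-slack filly
      ...   | no j≢s
        with swapAt-raised (∣+ₑ∣ x i) (∣+ₑ∣ y j)
               (subst (_< (x +ₑ i) s) (sym (+ₑ-other y (j≢s ∘ sym))) (<-≤-trans ys<xs (≤ᵥ-+ₑ x i s)))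
      ...     | t , x+i<y+j , R with x t <? y t
      ...       | yes xt<yt = t , xt<yt ,
        ν̃-mono₂ (-ₑ+ₑ-mono s t (≤ᵥ-+ₑ x i)) (-ₑ+ₑ-mono t s (≤ᵥ-+ₑ y j))
                (∣-ₑ+ₑ∣≤ (x +ₑ i) t (≤-trans (m<n⇒0<n ys<xs) (≤ᵥ-+ₑ x i s)) (∣+ₑ∣≤ x i ∣x∣<r))
                (∣-ₑ+ₑ∣≤ (y +ₑ j) s (m<n⇒0<n x+i<y+j) (∣+ₑ∣≤ y j ∣y∣<r))
        ⟨≤̄⟩ R ⟨≤̄⟩ +̄-mono fillx filly
      ...       | no xt≮yt = case t ≟ j of λ where
        (yes refl) → crossed j≢s filly (R ⟨≤̄⟩ +̄-mono fillx filly)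
        (no t≢j)   → contradiction x+i<y+j
          (≤⇒≯ (≤-trans (≤-reflexive (+ₑ-other y t≢j)) (≤-trans (≮⇒≥ xt≮yt) (≤ᵥ-+ₑ x i t))))

    exchangeAt-step : Fuel (suc m) x y → ∣ x ∣ ≤ r → ∣ y ∣ ≤ r → y s < x s → ExchangeAt ν̃ x y s
    exchangeAt-step {x} {y} fuel ∣x∣≤r ∣y∣≤r ys<xs with <-cmp ∣ x ∣ ∣ y ∣
    ... | tri< ∣x∣<∣y∣ _ _ = inj₁ (swapAt-< fuel ∣x∣<∣y∣ ∣y∣≤r ys<xs)
    ... | tri> _ _ ∣y∣<∣x∣ = exchangeAt-> fuel ∣y∣<∣x∣ ∣x∣≤r ys<xs
    ... | tri≈ _ ∣x∣≡∣y∣ _ with ∣ y ∣ <? r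
    ...   | yes ∣y∣<r = inj₁ (SameSize.swapAt-≡ fuel ∣x∣≡∣y∣ ∣y∣<r ys<xs)
    ...   | no ∣y∣≮r  = inj₁ (swapAt-full (trans ∣x∣≡∣y∣ ∣y∣≡r) ∣y∣≡r ys<xs)
      where
      ∣y∣≡r : ∣ y ∣ ≡ r
      ∣y∣≡r = ≤-antisym ∣y∣≤r (≮⇒≥ ∣y∣≮r)

  exchanges : ∀ m → Exchanges m
  exchanges zero = record
    { at      = λ fuel ∣x∣≤r ∣y∣≤r _ → ⊥-elim (no-fuel fuel ∣x∣≤r ∣y∣≤r)
    ; atSlack = λ fuel ∣x∣<∣y∣ ∣y∣≤r → ⊥-elim (no-fuel fuel (≤-trans (<⇒≤ ∣x∣<∣y∣) ∣y∣≤r) ∣y∣≤r)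
    }
  exchanges (suc m) = record { at = exchangeAt-step ; atSlack = exchangeAtSlack-< }
    where open Step (exchanges m)

  ν̃-isM♮Convex : IsM♮Convex r ν̃
  ν̃-isM♮Convex = record
    { ≗⇒≤̄             = λ u≗v ∣u∣≤r → ν̃-mono (≤ᵥ-reflexive u≗v) (subst (_≤ r) (∣∣-cong u≗v) ∣u∣≤r)
    ; nonempty        = nonempty
    ; exchangeAt      = Exchanges.at (exchanges _) full-tank
    ; exchangeAtSlack = Exchanges.atSlack (exchanges _) full-tank
    }
    where
    nonempty : ∃[ x ] ∣ x ∣ ≡ r × ν̃ x ≢ ∞
    nonempty =
      let x , ∣x∣ , νx≢∞ = proj₁ ν-convex
      in  x , ∣x∣ , λ ν̃x≡∞ → νx≢∞ (∞≤̄⇒≡∞ (subst (_≤̄ ν x) ν̃x≡∞ (ν̃≤ν ≤ᵥ-refl ∣x∣)))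

    full-tank : Fuel (suc (r + r)) x y
    full-tank {x} {y} = m≤n+m (suc (r + r)) (∣ x ∣ + ∣ y ∣)

proposition1p3 : ∀ {c ℓ₁ ℓ₂} (Γ : TotallyOrderedAbelianGroup c ℓ₁ ℓ₂) (q n r : ℕ)
    (ν : (Fin n → ℕ) → Extended.Γ̄ Γ) (ν̃ : (Fin n → ℕ) → Extended.Γ̄ Γ) →
    IsMConvex Γ r ν →
    IsMinExtension Γ r ν ν̃ →
    IsMConvex Γ {q + n} r (λ α̃ → ν̃ (restrictE {q} {n} α̃))
proposition1p3 Γ q n r ν ν̃ ν-convex ν̃-min =
  M♮Convexity.IsM♮Convex⇒IsMConvex-restrictE Γ ν̃-isM♮Convex q
  where open MinExtension Γ r ν ν̃ ν-convex ν̃-min using (ν̃-isM♮Convex)
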